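{- Let $\alpha=\sum_{\mathbf{s}}\alpha_{\mathbf{s}}\,z_{\mathbf{s}}\in\widehat{\mathfrak{h}}^1$ (with $\alpha_{\mathbf{s}}\in\mathbb{Q}$), and suppose there is a positive integer $k$ such that the denominator of each $\alpha_{\mathbf{s}}$ is $k$-th power free. Then for all sufficiently large primes $p$ the series \[ a_p:=\sum_{\mathbf{s}}\alpha_{\mathbf{s}}\,p^{w(\mathbf{s})}H_{p-1}(\mathbf{s}) \] is $p$-adically convergent and lies in $\mathbb{Z}_p$, and $\hat{\zeta}_\infty(\alpha)=[a_p]$.
   Context: A composition is a finite ordered tuple $\mathbf{s}=(s_1,\ldots,s_k)$ of positive integers (the empty composition is allowed), with weight $w(\mathbf{s})=s_1+\cdots+s_k$. For a positive integer $n$, $H_n(\mathbf{s})=\sum_{n\geq n_1>\cdots>n_k\geq 1}n_1^{ -s_1}\cdots n_k^{ -s_k}\in\mathbb{Q}$, with $H_n(\varnothing)=1$. $\widehat{\mathfrak{h}}^1$ is the $\mathbb{Q}$-vector space of formal infinite sums $\sum_{\mathbf{s}}\alpha_{\mathbf{s}}z_{\mathbf{s}}$ over all compositions, $\alpha_{\mathbf{s}}\in\mathbb{Q}$, where $z_{\mathbf{s}}=z_{s_1}\cdots z_{s_k}$ are words in noncommuting symbols $z_1,z_2,\ldots$ (with $z_n=x^{n-1}y$, of degree $n$); it is topologized by the subspaces $I_n$ of sums with $\alpha_{\mathbf{s}}=0$ whenever $w(\mathbf{s})<n$. For $n\geq1$ let $\mathcal{A}_n=\left(\prod_p\mathbb{Z}/p^n\mathbb{Z}\right)/\left(\bigoplus_p\mathbb{Z}/p^n\mathbb{Z}\right)$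 (product over primes), and let $\hat{\mathcal{A}}=\varprojlim_n\mathcal{A}_n$ via reduction maps, with projections $\pi_n:\hat{\mathcal{A}}\to\mathcal{A}_n$. Given $a_p\in\mathbb{Z}_p$ for all but finitely many primes $p$, $[a_p]\in\hat{\mathcal{A}}$ denotes the element whose image in each $\mathcal{A}_n$ is the class of $(a_p \bmod p^n)_p$. The weighted finite multiple zeta function $\hat{\zeta}_\infty:\widehat{\mathfrak{h}}^1\to\hat{\mathcal{A}}$ is the unique map with $\pi_n\hat{\zeta}_\infty\left(\sum_{\mathbf{s}}\alpha_{\mathbf{s}}z_{\mathbf{s}}\right)=\left[\sum_{w(\mathbf{s})<n}\alpha_{\mathbf{s}}p^{w(\mathbf{s})}H_{p-1}(\mathbf{s})+p^n\mathbb{Z}\right]$ for all $n\geq1$ (the class in $\mathcal{A}_n$ defined by these residues for all large $p$). -}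

module Defs where

open import Data.Nat as ℕ using (ℕ; zero; suc; NonZero; _<_; _≤_)
open import Data.Nat.Divisibility using (_∣_)
open import Data.Nat.Primality using (Prime)
open import Data.Integer as ℤ using (ℤ; +_)
open import Data.Rational using (ℚ; _/_; ↥_; ↧ₙ_; 0ℚ; 1ℚ; _+_; _*_; _-_)
open import Data.List using (List; []; _∷_; map; _++_; foldr; concatMap)
open import Data.List.Membership.Propositional using (_∈_)
open import Data.Product using (Σ; _×_; ∃; proj₁; _,_)
open import Relation.Binary.PropositionalEquality using (_≡_)
open import Relation.Nullary using (¬_)

Pos : Set
Pos = Σ ℕ NonZero

Composition : Set
Composition = List Pos

weight : Composition → ℕ
weight [] = 0
weight (s ∷ ss) = proj₁ s ℕ.+ weight ss

-- Explicit list of all compositions of weight m: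
-- a composition of m+1 is (1 ∷ c) for c of weight m, or c with its first
-- part increased by one, for c nonempty of weight m.
private
  incrFirst : Composition → List Composition
  incrFirst [] = []
  incrFirst ((a , _) ∷ ss) = ((suc a , _) ∷ ss) ∷ []

compositionsOfWeight : ℕ → List Composition
compositionsOfWeight zero = [] ∷ []
compositionsOfWeight (suc m) =
  map ((1 , _) ∷_) (compositionsOfWeight m) ++ concatMap incrFirst (compositionsOfWeight m)

qpow : ℚ → ℕ → ℚ
qpow x zero = 1ℚ
qpow x (suc n) = x * qpow x n

ℕ→ℚ : ℕ → ℚ
ℕ→ℚ n = + n / 1

sumℚ : List ℚ → ℚ
sumℚ = foldr _+_ 0ℚ

-- H_n(s) = Σ_{n ≥ n₁ > ⋯ > n_k ≥ 1} n₁^{-s₁} ⋯ n_k^{-s_k},  H_n(∅) = 1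
-- computed by recursion on n₁ (the largest index):
-- H_n(s₁ s') = Σ_{m=1}^{n} m^{-s₁} H_{m-1}(s').
H : ℕ → Composition → ℚ
H n [] = 1ℚ
H zero (s ∷ ss) = 0ℚ
H (suc n) (s ∷ ss) = qpow (+ 1 / suc n) (proj₁ s) * H n ss + H n (s ∷ ss)

KthPowerFree : ℕ → ℕ → Set
KthPowerFree k d = ∀ e → (e ℕ.^ k) ∣ d → e ≡ 1

-- x ∈ p^n ℤ_(p), i.e. v_p(x) ≥ n (for x in lowest terms):
-- p^n divides the numerator and p does not divide the denominator.
DivByPow : ℕ → ℕ → ℚ → Set
DivByPow p n x = ((p ℕ.^ n) ∣ ℤ.∣ ↥ x ∣) × ¬ (p ∣ (↧ₙ x))

CongMod : ℕ → ℕ → ℚ → ℚ → Set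
CongMod p n x y = DivByPow p n (x - y)

term : (Composition → ℚ) → ℕ → Composition → ℚ
term α p s = α s * (ℕ→ℚ (p ℕ.^ weight s) * H (ℕ.pred p) s)

truncSum : (Composition → ℚ) → ℕ → ℕ → ℚ
truncSum α p zero = 0ℚ
truncSum α p (suc N) =
  truncSum α p N + sumℚ (map (term α p) (compositionsOfWeight N))

-- The series Σ_s α_s p^{w(s)} H_{p-1}(s) converges p-adically to the element of ℤ_p
-- given by the compatible residues r : ℕ → ℤ (r n represents a_p mod p^n):
--  * terms tend to 0 p-adically (for every n, all terms of weight ≥ M lie in p^n ℤ_(p)),
--  * for every n, the partial sums are eventually ≡ r n (mod p^n).
ConvergesTo : (Composition → ℚ) → ℕ → (ℕ → ℤ) → Set
ConvergesTo α p r =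
  (∀ n → ∃ λ M → ∀ s → M ≤ weight s → DivByPow p n (term α p s)) ×
  (∀ n → ∃ λ M → ∀ N → M ≤ N → CongMod p n (truncSum α p N) (r n / 1))

-- Write k = suc K. For a prime p every H_{p-1}(s) is p-integral, since its denominators are
-- products of numbers below p, so p ^ w(s) H_{p-1}(s) lies in p ^ w(s) ℤ_(p). A k-th power free
-- denominator has p-part at most p ^ K, and none at all once p exceeds the denominators of the
-- coefficients of weight below K; for such p the term of weight w lies in p ^ (w ∸ K) ℤ_(p). So the
-- series converges p-adically and a_p ≡ (sum over weights below n + K) mod p ^ n. If p also exceeds
-- the denominators of weight below n + K, the terms of weight in [n, n + K) lie in p ^ n ℤ_(p), and
-- a_p ≡ (sum over weights below n) mod p ^ n.

module Submission where

open import Defs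
open import Data.Nat using (ℕ; _<_; _≤_; NonZero)
open import Data.Nat.Primality using (Prime)
open import Data.Integer using (ℤ)
open import Data.Rational using (ℚ; ↧ₙ_; _/_)
open import Data.Product using (Σ; ∃; _×_)

open import Data.Empty using (⊥-elim)
open import Data.List using (List; []; _∷_; map; _++_)
open import Data.List.Membership.Propositional using (_∈_; find)
open import Data.List.Membership.Propositional.Properties
  using (∈-map⁺; ∈-map⁻; ∈-++⁺ˡ; ∈-++⁺ʳ; ∈-++⁻; ∈-concatMap⁺; ∈-concatMap⁻)
open import Data.List.Relation.Unary.All as All using (All; []; _∷_)
import Data.List.Relation.Unary.All.Properties as All
open import Data.List.Relation.Unary.Any as Any using (here)
open import Data.Nat
  using (zero; suc; pred; _+_; _*_; _∸_; _^_; z≤n; _≤′_; ≤′-reflexive; ≤′-step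
        ; nonTrivial⇒≢1)
open import Data.Nat.Coprimality as Coprime using (Coprime; coprime-divisor; coprime-Bézout)
open import Data.Nat.Divisibility
  using ( _∣_; divides; _∣?_; ∣-refl; ∣-trans; _∣0; 1∣_; ∣1⇒≡1; ∣⇒≤; n∣m*n; ∣n⇒∣m*n
        ; *-pres-∣; *-monoˡ-∣)
open import Data.Nat.GCD using (module Bézout)
open import Data.Nat.ListAction using (product)
open import Data.Nat.ListAction.Properties using (∈⇒≤product)
open import Data.Nat.Primality
  using (prime⇒nonZero; prime⇒nonTrivial; prime⇒irreducible; euclidsLemma)
open import Data.Nat.Properties
  using ( *-assoc; *-comm; *-identityʳ; +-identityʳ; *-cancelʳ-≡; ^-distribˡ-+-*; m^n≢0
        ; m∸n+n≡m; m∸n≤m; m+n≤o⇒m≤o∸n; m≤m+n; m≤n⇒m≤1+n; m≤n⇒m<n∨m≡n; ≤-trans; <⇒≱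
        ; ≮⇒≥; <-trans; n<1+n; ≤-pred; m≤pred[n]⇒suc[m]≤n; ≤-refl; ≤-reflexive; _<?_
        ; ≤⇒≤′; ≤′⇒≤; *-commutativeSemigroup)
open import Algebra.Properties.CommutativeSemigroup *-commutativeSemigroup
  using (x∙yz≈y∙xz; xy∙z≈xz∙y; xy∙z≈x∙zy; xy∙z≈z∙xy)
open import Data.Integer using (+_)
import Data.Integer as ℤ
import Data.Integer.Divisibility.Signed as ℤ∣
open import Data.Integer.GCD using (gcd)
import Data.Integer.Properties as ℤP
import Data.Integer.Solver
import Data.Nat.Solver
open import Data.Rational using (mkℚ; ↥_; ↧_; 0ℚ; 1ℚ)
import Data.Rational as ℚ
import Data.Rational.Properties as ℚP
import Data.Rational.Solver
open import Data.Product using (_,_; proj₁; proj₂)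
open import Data.Sum using (inj₁; inj₂; [_,_]′)
open import Relation.Binary.PropositionalEquality
open import Relation.Nullary using (¬_; yes; no)

private
  module ℕ-Solver = Data.Nat.Solver.+-*-Solver
  module ℤ-Solver = Data.Integer.Solver.+-*-Solver
  module ℚ-Solver = Data.Rational.Solver.+-*-Solver

^-monoʳ-∣ : ∀ b {m n} → m ≤ n → b ^ m ∣ b ^ n
^-monoʳ-∣ b {m} {n} m≤n = divides (b ^ (n ∸ m)) (begin
  b ^ n               ≡⟨ cong (b ^_) (sym (m∸n+n≡m m≤n)) ⟩
  b ^ (n ∸ m + m)     ≡⟨ ^-distribˡ-+-* b (n ∸ m) m ⟩
  b ^ (n ∸ m) * b ^ m ∎)
  where open ≡-Reasoning

↥/↧-cross : ∀ i n .{{_ : NonZero n}} → ↥ (i / n) ℤ.* + n ≡ i ℤ.* ↧ (i / n)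
↥/↧-cross i n = begin
  ↥ q ℤ.* + n         ≡⟨ cong (↥ q ℤ.*_) (sym (ℚP.↧-/ i n)) ⟩
  ↥ q ℤ.* (↧ q ℤ.* g) ≡⟨ ℤ-Solver.solve 3 (λ a b c → a :* (b :* c) := a :* c :* b)
                           refl (↥ q) (↧ q) g ⟩
  ↥ q ℤ.* g ℤ.* ↧ q   ≡⟨ cong (ℤ._* ↧ q) (ℚP.↥-/ i n) ⟩
  i ℤ.* ↧ q           ∎
  where
  open ≡-Reasoning
  open ℤ-Solver using (_:*_; _:=_)
  q = i / n
  g = gcd i (+ n)

+-≡/ : ∀ x y → x ℚ.+ y ≡ (↥ x ℤ.* ↧ y ℤ.+ ↥ y ℤ.* ↧ x) / (↧ₙ x * ↧ₙ y)
+-≡/ (mkℚ _ _ _) (mkℚ _ _ _) = refl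

*-≡/ : ∀ x y → x ℚ.* y ≡ (↥ x ℤ.* ↥ y) / (↧ₙ x * ↧ₙ y)
*-≡/ (mkℚ _ _ _) (mkℚ _ _ _) = refl

-≡/ : ∀ x y → x ℚ.- y ≡ (↥ x ℤ.* ↧ y ℤ.- ↥ y ℤ.* ↧ x) / (↧ₙ x * ↧ₙ y)
-≡/ (mkℚ _ _ _) (mkℚ ℤ.-[1+ _ ] _ _) = refl
-≡/ (mkℚ _ _ _) (mkℚ (+ 0)      _ _) = refl
-≡/ (mkℚ _ _ _) (mkℚ ℤ.+[1+ _ ] _ _) = refl

↥-↧-coprime : ∀ x → Coprime ℤ.∣ ↥ x ∣ (↧ₙ x)
↥-↧-coprime (mkℚ _ _ c) = Coprime.recompute c

r/1≡mkℚ : ∀ r → r / 1 ≡ mkℚ r 0 (Coprime.sym (Coprime.1-coprimeTo ℤ.∣ r ∣))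
r/1≡mkℚ r = ℚP.↥p/↧p≡p (mkℚ r 0 _)

p^w*H : ℕ → Composition → ℚ
p^w*H p s = ℕ→ℚ (p ^ weight s) ℚ.* H (pred p) s

module _ {p : ℕ} (p-prime : Prime p) where

  private instance
    p≢0 : NonZero p
    p≢0 = prime⇒nonZero p-prime

  p≢1 : p ≢ 1
  p≢1 = nonTrivial⇒≢1 {{prime⇒nonTrivial p-prime}}

  p∤1 : ¬ p ∣ 1
  p∤1 p∣1 = p≢1 (∣1⇒≡1 p∣1)

  p∤-* : ∀ {a b} → ¬ p ∣ a → ¬ p ∣ b → ¬ p ∣ a * b
  p∤-* p∤a p∤b p∣ab = [ p∤a , p∤b ]′ (euclidsLemma _ _ p-prime p∣ab)

  p∤⇒coprime-^ : ∀ m {n} → ¬ p ∣ n → Coprime (p ^ m) n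
  p∤⇒coprime-^ zero    p∤n (d∣1 , _) = ∣1⇒≡1 d∣1
  p∤⇒coprime-^ (suc m) p∤n {d} (d∣p*p^m , d∣n) =
    p∤⇒coprime-^ m p∤n (coprime-divisor d⊥p d∣p*p^m , d∣n)
    where
    d⊥p : Coprime d p
    d⊥p (e∣d , e∣p) with prime⇒irreducible p-prime e∣p
    ... | inj₁ e≡1 = e≡1
    ... | inj₂ refl = ⊥-elim (p∤n (∣-trans e∣d d∣n))

  -- A / D is the reduced form of I / (p ^ j * n); its valuation is read off from I and j.
  lowestTerms-p-adic : ∀ m j {A D n I} → Coprime A D → A * (p ^ j * n) ≡ I * D →
                       p ^ (m + j) ∣ I → ¬ p ∣ n → p ^ m ∣ A × ¬ p ∣ D
  lowestTerms-p-adic m j {A} {D} {n} A⊥D eq (divides c refl) p∤n =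
    coprime-divisor (p∤⇒coprime-^ m p∤n) (divides (c * D) n*A≡) , p∤D
    where
    instance
      p^j≢0 : NonZero (p ^ j)
      p^j≢0 = m^n≢0 p j
    A*n≡ : A * n ≡ c * p ^ m * D
    A*n≡ = *-cancelʳ-≡ (A * n) (c * p ^ m * D) (p ^ j) (begin
      A * n * p ^ j           ≡⟨ xy∙z≈x∙zy A n (p ^ j) ⟩
      A * (p ^ j * n)         ≡⟨ eq ⟩
      c * p ^ (m + j) * D     ≡⟨ cong (λ z → c * z * D) (^-distribˡ-+-* p m j) ⟩
      c * (p ^ m * p ^ j) * D ≡⟨ ℕ-Solver.solve 4
                                   (λ c a b d → c :* (a :* b) :* d := c :* a :* d :* b)
                                   refl c (p ^ m) (p ^ j) D ⟩
      c * p ^ m * D * p ^ j   ∎)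
      where
      open ≡-Reasoning
      open ℕ-Solver using (_:*_; _:=_)
    n*A≡ : n * A ≡ c * D * p ^ m
    n*A≡ = trans (*-comm n A) (trans A*n≡ (xy∙z≈xz∙y c (p ^ m) D))
    p∤D : ¬ p ∣ D
    p∤D p∣D = p∤n (∣-trans p∣D (coprime-divisor (Coprime.sym A⊥D) (divides (c * p ^ m) A*n≡)))

  DivByPow-/-∣ : ∀ m j {n} i N .{{_ : NonZero N}} → N ∣ p ^ j * n → ¬ p ∣ n →
                 p ^ (m + j) ∣ ℤ.∣ i ∣ → DivByPow p m (i / N)
  DivByPow-/-∣ m j {n} i N (divides t p^j*n≡t*N) p∤n p^m+j∣i =
    lowestTerms-p-adic m j (↥-↧-coprime q) cross (∣n⇒∣m*n t p^m+j∣i) p∤n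
    where
    q = i / N
    cross : ℤ.∣ ↥ q ∣ * (p ^ j * n) ≡ t * ℤ.∣ i ∣ * ↧ₙ q
    cross = begin
      ℤ.∣ ↥ q ∣ * (p ^ j * n)  ≡⟨ cong (ℤ.∣ ↥ q ∣ *_) p^j*n≡t*N ⟩
      ℤ.∣ ↥ q ∣ * (t * N)      ≡⟨ x∙yz≈y∙xz ℤ.∣ ↥ q ∣ t N ⟩
      t * (ℤ.∣ ↥ q ∣ * N)      ≡⟨ cong (t *_) (sym (ℤP.abs-* (↥ q) (+ N))) ⟩
      t * ℤ.∣ ↥ q ℤ.* + N ∣    ≡⟨ cong (λ z → t * ℤ.∣ z ∣) (↥/↧-cross i N) ⟩
      t * ℤ.∣ i ℤ.* ↧ q ∣      ≡⟨ cong (t *_) (ℤP.abs-* i (↧ q)) ⟩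
      t * (ℤ.∣ i ∣ * ↧ₙ q)     ≡⟨ sym (*-assoc t ℤ.∣ i ∣ (↧ₙ q)) ⟩
      t * ℤ.∣ i ∣ * ↧ₙ q       ∎
      where open ≡-Reasoning

  DivByPow-/ : ∀ m i n .{{_ : NonZero n}} → ¬ p ∣ n → p ^ m ∣ ℤ.∣ i ∣ → DivByPow p m (i / n)
  DivByPow-/ m i n p∤n p^m∣i =
    DivByPow-/-∣ m 0 i n (n∣m*n 1) p∤n
      (subst (λ e → p ^ e ∣ ℤ.∣ i ∣) (sym (+-identityʳ m)) p^m∣i)

  DivByPow-0 : ∀ m → DivByPow p m 0ℚ
  DivByPow-0 m = (p ^ m) ∣0 , p∤1

  DivByPow-1 : DivByPow p 0 1ℚ
  DivByPow-1 = ∣-refl , p∤1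

  DivByPow-weaken : ∀ {m n} x → m ≤ n → DivByPow p n x → DivByPow p m x
  DivByPow-weaken _ m≤n (p^n∣↥x , p∤↧x) = ∣-trans (^-monoʳ-∣ p m≤n) p^n∣↥x , p∤↧x

  DivByPow-+ : ∀ {m} x y → DivByPow p m x → DivByPow p m y → DivByPow p m (x ℚ.+ y)
  DivByPow-+ {m} x y (p^m∣↥x , p∤↧x) (p^m∣↥y , p∤↧y) =
    subst (DivByPow p m) (sym (+-≡/ x y))
      (DivByPow-/ m (↥ x ℤ.* ↧ y ℤ.+ ↥ y ℤ.* ↧ x) (↧ₙ x * ↧ₙ y) (p∤-* p∤↧x p∤↧y)
        (ℤ∣.∣⇒∣ᵤ {+ (p ^ m)} p^m∣num))
    where
    p^m∣num : + (p ^ m) ℤ∣.∣ ↥ x ℤ.* ↧ y ℤ.+ ↥ y ℤ.* ↧ x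
    p^m∣num = ℤ∣.∣m∣n⇒∣m+n (ℤ∣.∣m⇒∣m*n (↧ y) (ℤ∣.∣ᵤ⇒∣ {+ (p ^ m)} {↥ x} p^m∣↥x))
                           (ℤ∣.∣m⇒∣m*n (↧ x) (ℤ∣.∣ᵤ⇒∣ {+ (p ^ m)} {↥ y} p^m∣↥y))

  DivByPow-* : ∀ {m n} x y → DivByPow p m x → DivByPow p n y → DivByPow p (m + n) (x ℚ.* y)
  DivByPow-* {m} {n} x y (p^m∣↥x , p∤↧x) (p^n∣↥y , p∤↧y) =
    subst (DivByPow p (m + n)) (sym (*-≡/ x y))
      (DivByPow-/ (m + n) (↥ x ℤ.* ↥ y) (↧ₙ x * ↧ₙ y) (p∤-* p∤↧x p∤↧y) p^m+n∣num)
    where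
    p^m+n∣num : p ^ (m + n) ∣ ℤ.∣ ↥ x ℤ.* ↥ y ∣
    p^m+n∣num = subst₂ _∣_ (sym (^-distribˡ-+-* p m n)) (sym (ℤP.abs-* (↥ x) (↥ y)))
                  (*-pres-∣ p^m∣↥x p^n∣↥y)

  DivByPow-*-den : ∀ m j {n} x y → ↧ₙ x ∣ p ^ j * n → ¬ p ∣ n →
                   DivByPow p (m + j) y → DivByPow p m (x ℚ.* y)
  DivByPow-*-den m j {n} x y ↧x∣p^j*n p∤n (p^m+j∣↥y , p∤↧y) =
    subst (DivByPow p m) (sym (*-≡/ x y))
      (DivByPow-/-∣ m j (↥ x ℤ.* ↥ y) (↧ₙ x * ↧ₙ y) den∣ (p∤-* p∤n p∤↧y) p^m+j∣num)
    where
    den∣ : ↧ₙ x * ↧ₙ y ∣ p ^ j * (n * ↧ₙ y)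
    den∣ = subst (↧ₙ x * ↧ₙ y ∣_) (*-assoc (p ^ j) n (↧ₙ y)) (*-monoˡ-∣ (↧ₙ y) ↧x∣p^j*n)
    p^m+j∣num : p ^ (m + j) ∣ ℤ.∣ ↥ x ℤ.* ↥ y ∣
    p^m+j∣num = subst (p ^ (m + j) ∣_) (sym (ℤP.abs-* (↥ x) (↥ y)))
                  (∣n⇒∣m*n ℤ.∣ ↥ x ∣ p^m+j∣↥y)

  DivByPow-neg : ∀ {m} x → DivByPow p m x → DivByPow p m (ℚ.- x)
  DivByPow-neg (mkℚ ℤ.-[1+ _ ] _ _) h = h
  DivByPow-neg (mkℚ (+ 0)      _ _) h = h
  DivByPow-neg (mkℚ ℤ.+[1+ _ ] _ _) h = h

  DivByPow-sumℚ : ∀ {m xs} → All (DivByPow p m) xs → DivByPow p m (sumℚ xs)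
  DivByPow-sumℚ {m} []                   = DivByPow-0 m
  DivByPow-sumℚ {m} {x ∷ xs} (px ∷ pxs) =
    DivByPow-+ {m} x (sumℚ xs) px (DivByPow-sumℚ {m} pxs)

  CongMod-refl : ∀ {m} x → CongMod p m x x
  CongMod-refl {m} x = subst (DivByPow p m) (sym (ℚP.+-inverseʳ x)) (DivByPow-0 m)

  CongMod-sym : ∀ {m} x y → CongMod p m x y → CongMod p m y x
  CongMod-sym {m} x y x≡y = subst (DivByPow p m) y-x≡ (DivByPow-neg {m} (x ℚ.- y) x≡y)
    where
    open ℚ-Solver using (_:-_; :-_; _:=_)
    y-x≡ : ℚ.- (x ℚ.- y) ≡ y ℚ.- x
    y-x≡ = ℚ-Solver.solve 2 (λ a b → :- (a :- b) := b :- a) refl x y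

  CongMod-trans : ∀ {m} x y z → CongMod p m x y → CongMod p m y z → CongMod p m x z
  CongMod-trans {m} x y z x≡y y≡z =
    subst (DivByPow p m) x-z≡ (DivByPow-+ {m} (x ℚ.- y) (y ℚ.- z) x≡y y≡z)
    where
    open ℚ-Solver using (_:+_; _:-_; _:=_)
    x-z≡ : (x ℚ.- y) ℚ.+ (y ℚ.- z) ≡ x ℚ.- z
    x-z≡ = ℚ-Solver.solve 3 (λ a b c → (a :- b) :+ (b :- c) := a :- c) refl x y z

  CongMod-+ʳ : ∀ {m} x y → DivByPow p m y → CongMod p m (x ℚ.+ y) x
  CongMod-+ʳ {m} x y p^m∣y = subst (DivByPow p m) y≡ p^m∣y
    where
    open ℚ-Solver using (_:+_; _:-_; _:=_)
    y≡ : y ≡ (x ℚ.+ y) ℚ.- x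
    y≡ = ℚ-Solver.solve 2 (λ a b → b := (a :+ b) :- a) refl x y

  inverse-mod-p^ : ∀ n {d} → ¬ p ∣ d → ∃ λ u → p ^ n ∣ ℤ.∣ + 1 ℤ.- u ℤ.* + d ∣
  inverse-mod-p^ n {d} p∤d with coprime-Bézout (Coprime.sym (p∤⇒coprime-^ n p∤d))
  ... | Bézout.+- u v 1+vP≡ud = + u , divides v (begin
    ℤ.∣ + 1 ℤ.- + u ℤ.* + d ∣            ≡⟨ cong (λ z → ℤ.∣ + 1 ℤ.- z ∣) (sym (ℤP.pos-* u d)) ⟩
    ℤ.∣ + 1 ℤ.- + (u * d) ∣              ≡⟨ cong (λ z → ℤ.∣ + 1 ℤ.- + z ∣) (sym 1+vP≡ud) ⟩
    ℤ.∣ + 1 ℤ.- + (1 + v * p ^ n) ∣      ≡⟨ cong (λ z → ℤ.∣ + 1 ℤ.- z ∣) (ℤP.pos-+ 1 (v * p ^ n)) ⟩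
    ℤ.∣ + 1 ℤ.- (+ 1 ℤ.+ + (v * p ^ n)) ∣ ≡⟨ cong ℤ.∣_∣ (ℤ-Solver.solve 1
                                              (λ w → con (+ 1) :- (con (+ 1) :+ w) := :- w)
                                              refl (+ (v * p ^ n))) ⟩
    ℤ.∣ ℤ.- + (v * p ^ n) ∣              ≡⟨ ℤP.∣-i∣≡∣i∣ (+ (v * p ^ n)) ⟩
    v * p ^ n                            ∎)
    where
    open ≡-Reasoning
    open ℤ-Solver using (con; _:+_; _:-_; :-_; _:=_)
  ... | Bézout.-+ u v 1+ud≡vP = ℤ.- + u , divides v (begin
    ℤ.∣ + 1 ℤ.- (ℤ.- + u) ℤ.* + d ∣  ≡⟨ cong ℤ.∣_∣ (ℤ-Solver.solve 2
                                          (λ a b → con (+ 1) :- (:- a) :* b := con (+ 1) :+ a :* b)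
                                          refl (+ u) (+ d)) ⟩
    ℤ.∣ + 1 ℤ.+ + u ℤ.* + d ∣        ≡⟨ cong (λ z → ℤ.∣ + 1 ℤ.+ z ∣) (sym (ℤP.pos-* u d)) ⟩
    ℤ.∣ + 1 ℤ.+ + (u * d) ∣          ≡⟨ cong ℤ.∣_∣ (sym (ℤP.pos-+ 1 (u * d))) ⟩
    1 + u * d                        ≡⟨ 1+ud≡vP ⟩
    v * p ^ n                        ∎)
    where
    open ≡-Reasoning
    open ℤ-Solver using (con; _:+_; _:*_; _:-_; :-_; _:=_)

  integer-representative : ∀ n x → ¬ p ∣ ↧ₙ x → ∃ λ r → CongMod p n x (r / 1)
  integer-representative n x p∤↧x with u , p^n∣1-u↧x ← inverse-mod-p^ n p∤↧x =
    r , subst (CongMod p n x) (sym (r/1≡mkℚ r))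
          (subst (DivByPow p n) (sym (-≡/ x y))
            (DivByPow-/ n num (↧ₙ x * 1) (p∤-* p∤↧x p∤1) p^n∣num))
    where
    r = ↥ x ℤ.* u
    y = mkℚ r 0 _
    num = ↥ x ℤ.* + 1 ℤ.- r ℤ.* ↧ x
    open ℤ-Solver using (con; _:*_; _:-_; _:=_)
    num≡ : num ≡ ↥ x ℤ.* (+ 1 ℤ.- u ℤ.* ↧ x)
    num≡ = ℤ-Solver.solve 3
             (λ a b c → a :* con (+ 1) :- a :* b :* c := a :* (con (+ 1) :- b :* c))
             refl (↥ x) u (↧ x)
    p^n∣num : p ^ n ∣ ℤ.∣ num ∣
    p^n∣num = subst (p ^ n ∣_)
                (sym (trans (cong ℤ.∣_∣ num≡) (ℤP.abs-* (↥ x) (+ 1 ℤ.- u ℤ.* ↧ x))))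
                (∣n⇒∣m*n ℤ.∣ ↥ x ∣ p^n∣1-u↧x)

  DivByPow-qpow : ∀ {x} a → DivByPow p 0 x → DivByPow p 0 (qpow x a)
  DivByPow-qpow zero        _         = DivByPow-1
  DivByPow-qpow {x} (suc a) x-integral =
    DivByPow-* {0} {0} x (qpow x a) x-integral (DivByPow-qpow a x-integral)

  H-integral : ∀ n s → n < p → DivByPow p 0 (H n s)
  H-integral n       []              _     = DivByPow-1
  H-integral zero    (_ ∷ _)         _     = DivByPow-0 0
  H-integral (suc n) (s@(a , _) ∷ ss) 1+n<p =
    DivByPow-+ {0} (qpow (+ 1 / suc n) a ℚ.* H n ss) (H n (s ∷ ss))
      (DivByPow-* {0} {0} (qpow (+ 1 / suc n) a) (H n ss)
        (DivByPow-qpow a 1/[1+n]-integral) (H-integral n ss n<p))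
      (H-integral n (s ∷ ss) n<p)
    where
    n<p : n < p
    n<p = <-trans (n<1+n n) 1+n<p
    1/[1+n]-integral : DivByPow p 0 (+ 1 / suc n)
    1/[1+n]-integral =
      DivByPow-/ 0 (+ 1) (suc n) (λ p∣1+n → <⇒≱ 1+n<p (∣⇒≤ p∣1+n)) (1∣ 1)

  p^w*H-DivByPow : ∀ s → DivByPow p (weight s) (p^w*H p s)
  p^w*H-DivByPow s =
    subst (λ e → DivByPow p e (p^w*H p s)) (+-identityʳ (weight s))
      (DivByPow-* {weight s} {0} (ℕ→ℚ (p ^ weight s)) (H (pred p) s)
        (DivByPow-/ (weight s) (+ (p ^ weight s)) 1 p∤1 ∣-refl)
        (H-integral (pred p) s (m≤pred[n]⇒suc[m]≤n ≤-refl)))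

  p-part-bounded : ∀ K {d} → ¬ p ^ suc K ∣ d → ∃ λ d′ → d ∣ p ^ K * d′ × ¬ p ∣ d′
  p-part-bounded K {d} p^1+K∤d with p ∣? d
  p-part-bounded K       {d} _       | no p∤d = d , n∣m*n (p ^ K) , p∤d
  p-part-bounded zero        p∤d     | yes p∣d =
    ⊥-elim (p∤d (subst (_∣ _) (sym (*-identityʳ p)) p∣d))
  p-part-bounded (suc K)     p^2+K∤d | yes (divides c refl) =
    let d′ , c∣p^K*d′ , p∤d′ = p-part-bounded K p^1+K∤c
    in  d′ , c*p∣p^[1+K]*d′ c∣p^K*d′ , p∤d′
    where
    p^1+K∤c : ¬ p ^ suc K ∣ c
    p^1+K∤c p^1+K∣c = p^2+K∤d (subst (_∣ c * p) (*-comm (p ^ suc K) p) (*-monoˡ-∣ p p^1+K∣c))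
    c*p∣p^[1+K]*d′ : ∀ {d′} → c ∣ p ^ K * d′ → c * p ∣ p ^ suc K * d′
    c*p∣p^[1+K]*d′ {d′} c∣p^K*d′ =
      subst (c * p ∣_) (trans (xy∙z≈z∙xy (p ^ K) d′ p) (sym (*-assoc p (p ^ K) d′)))
        (*-monoˡ-∣ p c∣p^K*d′)

∈-compositionsOfWeight⇒weight : ∀ m {s} → s ∈ compositionsOfWeight m → weight s ≡ m
∈-compositionsOfWeight⇒weight zero (here refl) = refl
∈-compositionsOfWeight⇒weight (suc m) s∈
  with ∈-++⁻ (map ((1 , _) ∷_) (compositionsOfWeight m)) s∈
... | inj₁ s∈1∷ with c , c∈ , refl ← ∈-map⁻ ((1 , _) ∷_) s∈1∷ =
  cong suc (∈-compositionsOfWeight⇒weight m c∈)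
-- The function hidden behind the wildcard is the private incrFirst of Defs.
... | inj₂ s∈incr with find (∈-concatMap⁻ _ {xs = compositionsOfWeight m} s∈incr)
... | (_ ∷ _) , c∈ , here refl = cong suc (∈-compositionsOfWeight⇒weight m c∈)

∈-compositionsOfWeight-suc∷ : ∀ a {ss} → ss ∈ compositionsOfWeight (weight ss) →
                              ((suc a , _) ∷ ss) ∈ compositionsOfWeight (suc a + weight ss)
∈-compositionsOfWeight-suc∷ zero    ss∈ = ∈-++⁺ˡ (∈-map⁺ ((1 , _) ∷_) ss∈)
∈-compositionsOfWeight-suc∷ (suc a) {ss} ss∈ =
  ∈-++⁺ʳ (map ((1 , _) ∷_) (compositionsOfWeight (suc a + weight ss)))
    (∈-concatMap⁺ _ (Any.map (λ { refl → here refl }) (∈-compositionsOfWeight-suc∷ a ss∈)))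

∈-compositionsOfWeight : ∀ s → s ∈ compositionsOfWeight (weight s)
∈-compositionsOfWeight []                 = here refl
∈-compositionsOfWeight ((suc a , _) ∷ ss) =
  ∈-compositionsOfWeight-suc∷ a (∈-compositionsOfWeight ss)

compositionsBelow : ℕ → List Composition
compositionsBelow zero    = []
compositionsBelow (suc N) = compositionsBelow N ++ compositionsOfWeight N

weight<⇒∈-compositionsBelow : ∀ {N} s → weight s < N → s ∈ compositionsBelow N
weight<⇒∈-compositionsBelow {suc N} s w<1+N with m≤n⇒m<n∨m≡n (≤-pred w<1+N)
... | inj₁ w<N  = ∈-++⁺ˡ (weight<⇒∈-compositionsBelow s w<N)
... | inj₂ refl = ∈-++⁺ʳ (compositionsBelow (weight s)) (∈-compositionsOfWeight s)

denominatorBound : (Composition → ℚ) → ℕ → ℕ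
denominatorBound α N = product (map (λ s → ↧ₙ (α s)) (compositionsBelow N))

denominatorBound<⇒∤ : ∀ α {N q} s → denominatorBound α N < q → weight s < N →
                      ¬ q ∣ ↧ₙ (α s)
denominatorBound<⇒∤ α {N} s D<q w<N q∣↧ =
  <⇒≱ D<q (≤-trans (∣⇒≤ q∣↧) (∈⇒≤product all-nonZero
    (∈-map⁺ (λ s → ↧ₙ (α s)) (weight<⇒∈-compositionsBelow s w<N))))
  where
  all-nonZero : All NonZero (map (λ s → ↧ₙ (α s)) (compositionsBelow N))
  all-nonZero = All.map⁺ (All.universal (λ _ → _) (compositionsBelow N))

module _ (α : Composition → ℚ) {p : ℕ} (p-prime : Prime p) where

  term-DivByPow-∸ : ∀ s j {d′} → ↧ₙ (α s) ∣ p ^ j * d′ → ¬ p ∣ d′ → j ≤ weight s →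
                    DivByPow p (weight s ∸ j) (term α p s)
  term-DivByPow-∸ s j ↧∣p^j*d′ p∤d′ j≤w =
    DivByPow-*-den p-prime (weight s ∸ j) j (α s) (p^w*H p s) ↧∣p^j*d′ p∤d′
      (subst (λ e → DivByPow p e (p^w*H p s)) (sym (m∸n+n≡m j≤w))
        (p^w*H-DivByPow p-prime s))

  term-DivByPow : ∀ s → ¬ p ∣ ↧ₙ (α s) → DivByPow p (weight s) (term α p s)
  term-DivByPow s p∤↧ = term-DivByPow-∸ s 0 (n∣m*n 1) p∤↧ z≤n

  term-DivByPow-powerFree : ∀ K s → KthPowerFree (suc K) (↧ₙ (α s)) →
                            (weight s < K → ¬ p ∣ ↧ₙ (α s)) → DivByPow p (weight s ∸ K) (term α p s)
  term-DivByPow-powerFree K s free p∤↧-light with weight s <? K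
  ... | yes w<K =
    DivByPow-weaken p-prime (term α p s) (m∸n≤m (weight s) K) (term-DivByPow s (p∤↧-light w<K))
  ... | no  w≮K =
    let d′ , ↧∣p^K*d′ , p∤d′ = p-part-bounded p-prime K (λ p^k∣↧ → p≢1 p-prime (free p p^k∣↧))
    in  term-DivByPow-∸ s K ↧∣p^K*d′ p∤d′ (≮⇒≥ w≮K)

  layer-DivByPow : ∀ {m} N → (∀ s → weight s ≡ N → DivByPow p m (term α p s)) →
                   DivByPow p m (sumℚ (map (term α p) (compositionsOfWeight N)))
  layer-DivByPow {m} N h = DivByPow-sumℚ p-prime {m}
    (All.map⁺ (All.tabulate (λ {s} s∈ → h s (∈-compositionsOfWeight⇒weight N s∈))))

  truncSum-DivByPow : ∀ {m} N → (∀ s → weight s < N → DivByPow p m (term α p s)) →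
                      DivByPow p m (truncSum α p N)
  truncSum-DivByPow {m} zero    _ = DivByPow-0 p-prime m
  truncSum-DivByPow {m} (suc N) h =
    DivByPow-+ p-prime {m} (truncSum α p N) (sumℚ (map (term α p) (compositionsOfWeight N)))
      (truncSum-DivByPow {m} N (λ s w<N → h s (m≤n⇒m≤1+n w<N)))
      (layer-DivByPow {m} N (λ s w≡N → h s (≤-reflexive (cong suc w≡N))))

  truncSum-CongMod : ∀ {m N N′} → N ≤′ N′ →
                     (∀ s → N ≤ weight s → weight s < N′ → DivByPow p m (term α p s)) →
                     CongMod p m (truncSum α p N′) (truncSum α p N)
  truncSum-CongMod {m} {N} (≤′-reflexive refl) _ = CongMod-refl p-prime {m} (truncSum α p N)
  truncSum-CongMod {m} {N} {suc N′} (≤′-step N≤′N′) h =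
    CongMod-trans p-prime {m} (truncSum α p (suc N′)) (truncSum α p N′) (truncSum α p N)
      (CongMod-+ʳ p-prime {m} (truncSum α p N′) (sumℚ (map (term α p) (compositionsOfWeight N′)))
        (layer-DivByPow {m} N′ (λ s w≡N′ →
          h s (subst (N ≤_) (sym w≡N′) (≤′⇒≤ N≤′N′)) (≤-reflexive (cong suc w≡N′)))))
      (truncSum-CongMod {m} N≤′N′ (λ s N≤w w<N′ → h s N≤w (m≤n⇒m≤1+n w<N′)))

module _ (α : Composition → ℚ) (K : ℕ) (powerFree : ∀ s → KthPowerFree (suc K) (↧ₙ (α s)))
         {p : ℕ} (D<p : denominatorBound α K < p) (p-prime : Prime p) where

  term-DivByPow-∸K : ∀ s → DivByPow p (weight s ∸ K) (term α p s)
  term-DivByPow-∸K s =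
    term-DivByPow-powerFree α p-prime K s (powerFree s) (denominatorBound<⇒∤ α s D<p)

  truncSum-integral : ∀ N → ¬ p ∣ ↧ₙ (truncSum α p N)
  truncSum-integral N = proj₂ (truncSum-DivByPow α p-prime {0} N (λ s _ →
    DivByPow-weaken p-prime (term α p s) (z≤n {weight s ∸ K}) (term-DivByPow-∸K s)))

  -- a_p modulo p ^ n is read off from the terms of weight below n + K.
  representative : ∀ n → ∃ λ r → CongMod p n (truncSum α p (n + K)) (r / 1)
  representative n =
    integer-representative p-prime n (truncSum α p (n + K)) (truncSum-integral (n + K))

  residue : ℕ → ℤ
  residue n = proj₁ (representative n)

  residue-CongMod : ∀ n → CongMod p n (truncSum α p (n + K)) (residue n / 1)
  residue-CongMod n = proj₂ (representative n)

  term-DivByPow-heavy : ∀ n s → n + K ≤ weight s → DivByPow p n (term α p s)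
  term-DivByPow-heavy n s n+K≤w =
    DivByPow-weaken p-prime (term α p s) (m+n≤o⇒m≤o∸n n n+K≤w) (term-DivByPow-∸K s)

  truncSum-convergesTo-residue : ConvergesTo α p residue
  truncSum-convergesTo-residue =
    (λ n → n + K , term-DivByPow-heavy n) ,
    (λ n → n + K , λ N n+K≤N →
      CongMod-trans p-prime {n} (truncSum α p N) (truncSum α p (n + K)) (residue n / 1)
        (truncSum-CongMod α p-prime {n} (≤⇒≤′ n+K≤N) (λ s n+K≤w _ → term-DivByPow-heavy n s n+K≤w))
        (residue-CongMod n))

  residue-CongMod-truncSum : ∀ n → denominatorBound α (n + K) < p →
                             CongMod p n (residue n / 1) (truncSum α p n)
  residue-CongMod-truncSum n D[n+K]<p =
    CongMod-trans p-prime {n} (residue n / 1) (truncSum α p (n + K)) (truncSum α p n)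
      (CongMod-sym p-prime {n} (truncSum α p (n + K)) (residue n / 1) (residue-CongMod n))
      (truncSum-CongMod α p-prime {n} (≤⇒≤′ (m≤m+n n K)) (λ s n≤w w<n+K →
        DivByPow-weaken p-prime (term α p s) n≤w
          (term-DivByPow α p-prime s (denominatorBound<⇒∤ α s D[n+K]<p w<n+K))))

proposition1 : (α : Composition → ℚ) → (k : ℕ) → .{{_ : NonZero k}} →
    (∀ s → KthPowerFree k (↧ₙ (α s))) →
    ∃ λ P → Σ ((p : ℕ) → P < p → Prime p → ℕ → ℤ) λ a →
      (∀ p → (P<p : P < p) → (pp : Prime p) → ConvergesTo α p (a p P<p pp)) ×
      (∀ n → ∃ λ Q → ∀ p → (P<p : P < p) → (pp : Prime p) → Q < p →
        CongMod p n (a p P<p pp n / 1) (truncSum α p n))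
proposition1 α (suc K) powerFree =
  denominatorBound α K ,
  (λ p D<p p-prime → residue α K powerFree D<p p-prime) ,
  (λ p D<p p-prime → truncSum-convergesTo-residue α K powerFree D<p p-prime) ,
  (λ n → denominatorBound α (n + K) , λ p D<p p-prime →
    residue-CongMod-truncSum α K powerFree D<p p-prime n)
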